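{- If $G$ is a finite simple chordless graph with maximum degree $\Delta(G)\geq 3$, then any two proper $(\Delta(G)+1)$-edge-colorings of $G$ are $K$-equivalent.
   Context: A (proper) $t$-coloring of a graph $G$ is a map $\alpha:E(G)\to\{1,\dots,t\}$ such that adjacent edges receive distinct colors. Given a proper edge coloring and two distinct colors $c,d$, a Kempe chain is a connected component of the subgraph formed by the edges colored $c$ or $d$; a $K$-change consists of selecting a Kempe chain and swapping the two colors on its edges. Two $t$-colorings are $K$-equivalent if one can be obtained from the other by a finite sequence of $K$-changes using only colors from $\{1,\dots,t\}$. A graph is chordless if no cycle $C$ of $G$ has a chord, i.e. an edge of $G$ joining two nonconsecutive vertices of $C$. -}

module Defs where

open import Data.Bool using (Bool; true; false; T)
open import Data.Nat as ℕ using (ℕ; zero; suc; _⊔_; _∸_)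
open import Data.Fin as Fin using (Fin; toℕ)
open import Data.List using (List; length; filter; map; foldr)
open import Data.List using () renaming (allFin to allFinL)
open import Data.Product using (Σ; _×_; _,_; proj₁; proj₂; ∃; ∃-syntax)
open import Data.Sum using (_⊎_)
open import Relation.Nullary using (¬_; Dec; yes; no)
open import Relation.Binary.PropositionalEquality using (_≡_; _≢_)
open import Relation.Binary.Construct.Closure.ReflexiveTransitive using (Star)
open import Data.Fin.Properties using (_≟_)

record Graph (n : ℕ) : Set where
  field
    adj    : Fin n → Fin n → Bool
    sym    : ∀ u v → adj u v ≡ adj v u
    irrefl : ∀ v → adj v v ≡ false

open Graph public

Adj : ∀ {n} → Graph n → Fin n → Fin n → Set
Adj G u v = T (adj G u v)

degree : ∀ {n} → Graph n → Fin n → ℕ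
degree {n} G v = length (filter (λ u → T? (adj G v u)) (allFinL n))
  where
  T? : (b : Bool) → Dec (T b)
  T? true  = yes _
  T? false = no (λ ())

maxDegree : ∀ {n} → Graph n → ℕ
maxDegree {n} G = foldr _⊔_ 0 (map (degree G) (allFinL n))

-- Edges: each edge {u,v} is represented once, as (u , v) with u < v.

Edge : ∀ {n} → Graph n → Set
Edge {n} G = Σ (Fin n × Fin n) λ p → (proj₁ p Fin.< proj₂ p) × Adj G (proj₁ p) (proj₂ p)

ends : ∀ {n} (G : Graph n) → Edge G → Fin n × Fin n
ends G = proj₁

Share : ∀ {n} (G : Graph n) → Edge G → Edge G → Set
Share G e f = let (u , v) = ends G e ; (x , y) = ends G f in
  (u ≡ x ⊎ u ≡ y) ⊎ (v ≡ x ⊎ v ≡ y)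

AdjEdges : ∀ {n} (G : Graph n) → Edge G → Edge G → Set
AdjEdges G e f = ends G e ≢ ends G f × Share G e f

-- Edge colorings with colors Fin t (i.e. the t colors 1,…,t).

Coloring : ∀ {n} → Graph n → ℕ → Set
Coloring G t = Edge G → Fin t

Proper : ∀ {n t} (G : Graph n) → Coloring G t → Set
Proper G α = ∀ e f → AdjEdges G e f → α e ≢ α f

InCD : ∀ {n t} (G : Graph n) → Coloring G t → Fin t → Fin t → Edge G → Set
InCD G α c d e = α e ≡ c ⊎ α e ≡ d

-- a Kempe chain: the edge set S (decidable) of a connected component of the
-- subgraph formed by the edges colored c or d
IsKempeChain : ∀ {n t} {G : Graph n} → Coloring G t → Fin t → Fin t →
               (Edge G → Bool) → Set
IsKempeChain {G = G} α c d S =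
    (∀ e → T (S e) → InCD G α c d e)
  × (∃[ e ] T (S e))
  × (∀ e f → T (S e) → InCD G α c d f → Share G e f → T (S f))
  × (∀ e f → T (S e) → T (S f) → Star Step e f)
  where
  Step : Edge G → Edge G → Set
  Step e f = T (S e) × T (S f) × Share G e f

swap : ∀ {t} → Fin t → Fin t → Fin t → Fin t
swap c d x with x ≟ c
... | yes _ = d
... | no _ with x ≟ d
...   | yes _ = c
...   | no _  = x

KChange : ∀ {n t} {G : Graph n} → Coloring G t → Coloring G t → Set
KChange {t = t} {G = G} α β =
  Σ (Fin t) λ c → Σ (Fin t) λ d → Σ (Edge G → Bool) λ S →
      c ≢ d
    × IsKempeChain {G = G} α c d S
    × (∀ e → T (S e) → β e ≡ swap c d (α e))
    × (∀ e → ¬ T (S e) → β e ≡ α e)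

KEquiv : ∀ {n t} (G : Graph n) → Coloring G t → Coloring G t → Set
KEquiv G = Star (KChange {G = G})

Consec : ∀ {k} → Fin k → Fin k → Set
Consec {k} i j = toℕ j ≡ suc (toℕ i) ⊎ (toℕ i ≡ k ∸ 1 × toℕ j ≡ 0)

IsCycle : ∀ {n} → Graph n → (k : ℕ) → (Fin k → Fin n) → Set
IsCycle G k cyc =
    3 ℕ.≤ k
  × (∀ i j → cyc i ≡ cyc j → i ≡ j)
  × (∀ i j → Consec i j → Adj G (cyc i) (cyc j))

Chordless : ∀ {n} → Graph n → Set
Chordless G = ∀ k cyc → IsCycle G k cyc →
  ∀ i j → Adj G (cyc i) (cyc j) → Consec i j ⊎ Consec j i

-- Chordless graphs are 2-degenerate in an edge form: every nonempty edge set L has an edge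
-- e = vx such that v meets at most one other edge of L. (Take the start v of a maximal path
-- in L: all L-neighbours of v lie on the path, and two of them beyond the second vertex
-- would give a cycle with a chord.)
-- Induct on |L|. The Kempe changes joining the two colourings on L − e lift to L one at a
-- time, changing besides the chain only the colour of e, and a last single-edge change fixes
-- e. A change in colours c, d lifts trivially unless e has colour c, say, and meets the chain,
-- whose edges at e then have colour d. If one end of e sees no d, the chain just absorbs e.
-- Otherwise e is first recoloured with a colour missing at x (x has at most Δ edges), which
-- is missing at v as well, since the only other edge at v has colour d.

module Submission where

open import Defs renaming (sym to adj-sym)
open import Data.Bool using (Bool; T; _∨_)
open import Data.Bool.Properties using (T-irrelevant; T-∨)
open import Data.Nat as ℕ using (ℕ; zero; suc; _≤_; _<_; _⊔_; z≤n; s≤s)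
import Data.Nat.Properties as ℕP
open import Data.Fin as Fin using (Fin; toℕ)
import Data.Fin.Properties as FinP
open import Data.List using (List; []; _∷_; length; filter; map; foldr; cartesianProduct; lookup)
  renaming (allFin to allFinL)
open import Data.List.Properties using (filter-notAll)
open import Data.List.Membership.Propositional using (_∈_; find; lose)
open import Data.List.Membership.Propositional.Properties
  using (∈-filter⁺; ∈-filter⁻; ∈-allFin; ∈-cartesianProduct⁺)
open import Data.List.Relation.Unary.Any using (here; there; index; any?)
open import Data.List.Relation.Unary.Any.Properties using (lookup-index)
open import Data.Product using (Σ; ∃; _×_; _,_; proj₁; proj₂)
open import Data.Product.Properties using (≡-dec)
open import Data.Sum as Sum using (_⊎_; inj₁; inj₂)
open import Function using (_∘_; Injective)
open import Function.Bundles using (Equivalence)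
open import Relation.Nullary
  using (¬_; Dec; yes; no; contradiction; ¬?; _×-dec_; _⊎-dec_; decidable-stable)
open import Relation.Nullary.Decidable using (T?; map′; ⌊_⌋; toWitness; fromWitness)
open import Relation.Unary using (Decidable; _⊆_; _≐_)
open import Relation.Binary.Definitions using (DecidableEquality; tri<; tri≈; tri>)
open import Relation.Binary.PropositionalEquality hiding ([_])
open import Relation.Binary.Construct.Closure.ReflexiveTransitive using (Star; ε; _◅_; _◅◅_; gmap)
open import Relation.Binary.Construct.Closure.Transitive using (TransClosure; [_]; _∷_; _∷ʳ_; _++_)

OneOf : ∀ {t} → Fin t → Fin t → Fin t → Set
OneOf c d x = x ≡ c ⊎ x ≡ d

OneOf? : ∀ {t} (c d x : Fin t) → Dec (OneOf c d x)
OneOf? c d x = x Fin.≟ c ⊎-dec x Fin.≟ d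

module _ {t} (c d : Fin t) where

  swap-fst : swap c d c ≡ d
  swap-fst with c Fin.≟ c
  ... | yes _  = refl
  ... | no c≢c = contradiction refl c≢c

  swap-snd : swap c d d ≡ c
  swap-snd with d Fin.≟ c
  ... | yes d≡c = d≡c
  ... | no _ with d Fin.≟ d
  ...   | yes _  = refl
  ...   | no d≢d = contradiction refl d≢d

  swap-other : ∀ {x} → x ≢ c → x ≢ d → swap c d x ≡ x
  swap-other {x} x≢c x≢d with x Fin.≟ c
  ... | yes x≡c = contradiction x≡c x≢c
  ... | no _ with x Fin.≟ d
  ...   | yes x≡d = contradiction x≡d x≢d
  ...   | no _    = refl

  swap-involutive : ∀ x → swap c d (swap c d x) ≡ x
  swap-involutive x = by-cases (x Fin.≟ c) (x Fin.≟ d)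
    where
    by-cases : Dec (x ≡ c) → Dec (x ≡ d) → swap c d (swap c d x) ≡ x
    by-cases (yes refl) _          = trans (cong (swap c d) swap-fst) swap-snd
    by-cases (no _)     (yes refl) = trans (cong (swap c d) swap-snd) swap-fst
    by-cases (no x≢c)   (no x≢d)   =
      trans (cong (swap c d) (swap-other x≢c x≢d)) (swap-other x≢c x≢d)

  swap-injective : ∀ {x y} → swap c d x ≡ swap c d y → x ≡ y
  swap-injective {x} {y} eq =
    trans (sym (swap-involutive x)) (trans (cong (swap c d) eq) (swap-involutive y))

  swap-OneOf : ∀ {x} → OneOf c d x → OneOf c d (swap c d x)
  swap-OneOf (inj₁ refl) = inj₂ swap-fst
  swap-OneOf (inj₂ refl) = inj₁ swap-snd

  OneOf-swap : ∀ {a z} → OneOf c d a → OneOf c d z → z ≡ a ⊎ z ≡ swap c d a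
  OneOf-swap (inj₁ refl) (inj₁ z≡c) = inj₁ z≡c
  OneOf-swap (inj₁ refl) (inj₂ z≡d) = inj₂ (trans z≡d (sym swap-fst))
  OneOf-swap (inj₂ refl) (inj₁ z≡c) = inj₂ (trans z≡c (sym swap-snd))
  OneOf-swap (inj₂ refl) (inj₂ z≡d) = inj₁ z≡d

search : ∀ {a p} {A : Set a} {P : A → Set p} → Decidable P → (xs : List A) →
         (∃ λ x → x ∈ xs × P x) ⊎ (∀ x → x ∈ xs → ¬ P x)
search P? xs with any? P? xs
... | yes some = inj₁ (find some)
... | no none  = inj₂ (λ x x∈xs px → none (lose x∈xs px))

injective⇒≤-length : ∀ {a m} {A : Set a} (xs : List A) (f : Fin m → A) →
                     (∀ i → f i ∈ xs) → Injective _≡_ _≡_ f → m ≤ length xs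
injective⇒≤-length xs f f∈xs f-injective = FinP.injective⇒≤ position-injective
  where
  position : ∀ i → f i ≡ lookup xs (index (f∈xs i))
  position i = lookup-index (f∈xs i)
  position-injective : Injective _≡_ _≡_ (λ i → index (f∈xs i))
  position-injective {i} {j} eq =
    f-injective (trans (position i) (trans (cong (lookup xs) eq) (sym (position j))))

foldr-⊔-upper : ∀ {a} {A : Set a} (f : A → ℕ) {x xs} → x ∈ xs → f x ≤ foldr _⊔_ 0 (map f xs)
foldr-⊔-upper f {xs = y ∷ ys} (here refl) = ℕP.m≤m⊔n (f y) _
foldr-⊔-upper f {xs = y ∷ ys} (there x∈ys) =
  ℕP.≤-trans (foldr-⊔-upper f x∈ys) (ℕP.m≤n⊔m (f y) _)

foldr-⊔-positive : ∀ {a} {A : Set a} (f : A → ℕ) xs → 0 < foldr _⊔_ 0 (map f xs) → ∃ λ x → 0 < f x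
foldr-⊔-positive f (x ∷ xs) pos with f x in fx
... | zero  = foldr-⊔-positive f xs pos
... | suc _ = x , subst (0 <_) (sym fx) (s≤s z≤n)

filter-nonempty : ∀ {a p} {A : Set a} {P : A → Set p} (P? : Decidable P) xs →
                  0 < length (filter P? xs) → ∃ P
filter-nonempty P? (x ∷ xs) pos with P? x
... | yes px = x , px
... | no _   = filter-nonempty P? xs pos

module Edges {n} (G : Graph n) where

  ends-injective : {e f : Edge G} → ends G e ≡ ends G f → e ≡ f
  ends-injective {_ , u<w , uw} {_ , u<w′ , uw′} refl =
    cong₂ (λ l a → _ , l , a) (FinP.<-irrelevant u<w u<w′) (T-irrelevant uw uw′)

  _≟ᵉ_ : DecidableEquality (Edge G)
  e ≟ᵉ f = map′ ends-injective (cong (ends G)) (≡-dec Fin._≟_ Fin._≟_ (ends G e) (ends G f))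

  adjacent : ∀ {e f} → e ≢ f → Share G e f → AdjEdges G e f
  adjacent e≢f share = (λ same-ends → e≢f (ends-injective same-ends)) , share

  Incident : Fin n → Edge G → Set
  Incident w f = w ≡ proj₁ (ends G f) ⊎ w ≡ proj₂ (ends G f)

  Incident? : ∀ w f → Dec (Incident w f)
  Incident? w f = w Fin.≟ proj₁ (ends G f) ⊎-dec w Fin.≟ proj₂ (ends G f)

  Share? : ∀ e f → Dec (Share G e f)
  Share? e f = Incident? (proj₁ (ends G e)) f ⊎-dec Incident? (proj₂ (ends G e)) f

  Share-sym : ∀ e f → Share G e f → Share G f e
  Share-sym _ _ (inj₁ (inj₁ p)) = inj₁ (inj₁ (sym p))
  Share-sym _ _ (inj₁ (inj₂ p)) = inj₂ (inj₁ (sym p))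
  Share-sym _ _ (inj₂ (inj₁ p)) = inj₁ (inj₂ (sym p))
  Share-sym _ _ (inj₂ (inj₂ p)) = inj₂ (inj₂ (sym p))

  incident-Share : ∀ {w} f g → Incident w f → Incident w g → Share G f g
  incident-Share _ _ (inj₁ refl) w∈g = inj₁ w∈g
  incident-Share _ _ (inj₂ refl) w∈g = inj₂ w∈g

  data Joins (e : Edge G) (u w : Fin n) : Set where
    forward  : ends G e ≡ (u , w) → Joins e u w
    backward : ends G e ≡ (w , u) → Joins e u w

  Joins-sym : ∀ {e u w} → Joins e u w → Joins e w u
  Joins-sym (forward eq)  = backward eq
  Joins-sym (backward eq) = forward eq

  Joins-incident : ∀ {e u w} → Joins e u w → Incident u e
  Joins-incident (forward refl)  = inj₁ refl
  Joins-incident (backward refl) = inj₂ refl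

  Joins-Share : ∀ {e u w} f → Joins e u w → Share G e f → Incident u f ⊎ Incident w f
  Joins-Share _ (forward refl)  share = share
  Joins-Share _ (backward refl) share = Sum.swap share

  ordered : ∀ {u w} e → ends G e ≡ (u , w) → u Fin.< w
  ordered e refl = proj₁ (proj₂ e)

  Joins-adj : ∀ {e u w} → Joins e u w → Adj G u w
  Joins-adj {e} (forward refl) = proj₂ (proj₂ e)
  Joins-adj {e} {u} {w} (backward refl) = subst T (adj-sym G w u) (proj₂ (proj₂ e))

  Joins-irrefl : ∀ {e u} → ¬ Joins e u u
  Joins-irrefl {e} (forward eq)  = FinP.<-irrefl refl (ordered e eq)
  Joins-irrefl {e} (backward eq) = FinP.<-irrefl refl (ordered e eq)

  Joins-injective : ∀ {e f u w} → Joins e u w → Joins f u w → e ≡ f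
  Joins-injective (forward p)  (forward q)  = ends-injective (trans p (sym q))
  Joins-injective (backward p) (backward q) = ends-injective (trans p (sym q))
  Joins-injective {e} {f} (forward p) (backward q) =
    contradiction (ordered e p) (FinP.<-asym (ordered f q))
  Joins-injective {e} {f} (backward p) (forward q) =
    contradiction (ordered f q) (FinP.<-asym (ordered e p))

  -- meaningful only for an incident vertex w
  other : Fin n → Edge G → Fin n
  other w f with proj₁ (ends G f) Fin.≟ w
  ... | yes _ = proj₂ (ends G f)
  ... | no _  = proj₁ (ends G f)

  Joins-other : ∀ {w f} → Incident w f → Joins f w (other w f)
  Joins-other {w} {f} w∈f with proj₁ (ends G f) Fin.≟ w | w∈f
  ... | yes refl | _         = forward refl
  ... | no w≢u   | inj₁ w≡u  = contradiction (sym w≡u) w≢u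
  ... | no _     | inj₂ refl = backward refl

  edgeBetween : ∀ {u w} → Adj G u w → Edge G
  edgeBetween {u} {w} uw with FinP.<-cmp u w
  ... | tri< u<w _ _ = (u , w) , u<w , uw
  ... | tri≈ _ refl _ = contradiction (subst T (irrefl G u) uw) (λ ())
  ... | tri> _ _ w<u = (w , u) , w<u , subst T (adj-sym G u w) uw

  edgesAmong : List (Fin n × Fin n) → List (Edge G)
  edgesAmong [] = []
  edgesAmong ((u , w) ∷ ps) with u Fin.<? w | T? (adj G u w)
  ... | yes u<w | yes uw = ((u , w) , u<w , uw) ∷ edgesAmong ps
  ... | _       | _      = edgesAmong ps

  ∈-edgesAmong : ∀ {ps} e → ends G e ∈ ps → e ∈ edgesAmong ps
  ∈-edgesAmong {(u , w) ∷ ps} e e∈ps with u Fin.<? w | T? (adj G u w) | e∈ps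
  ... | yes _   | yes _  | here refl  = here (ends-injective refl)
  ... | yes _   | yes _  | there e∈ = there (∈-edgesAmong e e∈)
  ... | no u≮w  | _      | here refl  = contradiction (proj₁ (proj₂ e)) u≮w
  ... | no _    | _      | there e∈ = ∈-edgesAmong e e∈
  ... | yes _   | no ¬uw | here refl  = contradiction (proj₂ (proj₂ e)) ¬uw
  ... | yes _   | no _   | there e∈ = ∈-edgesAmong e e∈

  allEdges : List (Edge G)
  allEdges = edgesAmong (cartesianProduct (allFinL n) (allFinL n))

  ∈-allEdges : ∀ e → e ∈ allEdges
  ∈-allEdges e = ∈-edgesAmong e (∈-cartesianProduct⁺ (∈-allFin _) (∈-allFin _))

  remove : Edge G → List (Edge G) → List (Edge G)
  remove e = filter (λ f → ¬? (f ≟ᵉ e))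

  ∈-remove⁺ : ∀ {e f L} → f ∈ L → f ≢ e → f ∈ remove e L
  ∈-remove⁺ {e} = ∈-filter⁺ (λ f → ¬? (f ≟ᵉ e))

  ∈-remove⁻ : ∀ {e f} L → f ∈ remove e L → f ∈ L × f ≢ e
  ∈-remove⁻ {e} L = ∈-filter⁻ (λ f → ¬? (f ≟ᵉ e)) {xs = L}

  length-remove : ∀ {e L} → e ∈ L → length (remove e L) < length L
  length-remove {e} {L} e∈L = filter-notAll (λ f → ¬? (f ≟ᵉ e)) L (lose e∈L (λ e≢e → e≢e refl))

  degree≤maxDegree : ∀ x → degree G x ≤ maxDegree G
  degree≤maxDegree x = foldr-⊔-upper (degree G) (∈-allFin x)

  positive-maxDegree⇒Edge : 0 < maxDegree G → Edge G
  positive-maxDegree⇒Edge pos =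
    let x , deg-x = foldr-⊔-positive (degree G) (allFinL n) pos
        _ , x-y   = filter-nonempty _ (allFinL n) deg-x
    in edgeBetween x-y

  module _ {t} (φ : Coloring G t) where

    colours-at-bound : ∀ x → (∀ b → ∃ λ f → Incident x f × φ f ≡ b) → t ≤ degree G x
    colours-at-bound x present =
      injective⇒≤-length (filter _ (allFinL n)) neighbour
        (λ b → ∈-filter⁺ _ (∈-allFin (neighbour b)) (Joins-adj (joins b)))
        neighbour-injective
      where
      neighbour : Fin t → Fin n
      neighbour b = other x (proj₁ (present b))
      joins : ∀ b → Joins (proj₁ (present b)) x (neighbour b)
      joins b = Joins-other (proj₁ (proj₂ (present b)))
      neighbour-injective : Injective _≡_ _≡_ neighbour
      neighbour-injective {b} {b′} eq =
        trans (sym (proj₂ (proj₂ (present b))))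
          (trans (cong φ (Joins-injective (joins b) joins′)) (proj₂ (proj₂ (present b′))))
        where
        joins′ : Joins (proj₁ (present b′)) x (neighbour b)
        joins′ = subst (Joins (proj₁ (present b′)) x) (sym eq) (joins b′)

    missing-colour : ∀ x → degree G x < t → (L : List (Edge G)) →
                     ∃ λ b → ∀ f → f ∈ L → Incident x f → φ f ≢ b
    missing-colour x deg<t L =
      let b , ¬occurs = FinP.¬∀⟶∃¬ t Occurs Occurs? (ℕP.<⇒≱ deg<t ∘ colours-at-bound x ∘ forget-∈)
      in  b , λ f f∈L x∈f φf≡b → ¬occurs (f , f∈L , x∈f , φf≡b)
      where
      Occurs : Fin t → Set
      Occurs b = ∃ λ f → f ∈ L × Incident x f × φ f ≡ b
      Occurs? : ∀ b → Dec (Occurs b)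
      Occurs? b = map′ find (λ (_ , f∈L , occ) → lose f∈L occ)
                    (any? (λ f → Incident? x f ×-dec φ f Fin.≟ b) L)
      forget-∈ : (∀ b → Occurs b) → ∀ b → ∃ λ f → Incident x f × φ f ≡ b
      forget-∈ occurs b = let f , _ , occ = occurs b in f , occ

  record ReducibleEdge (L : List (Edge G)) : Set where
    field
      edge         : Edge G
      edge∈L       : edge ∈ L
      light far    : Fin n
      joins        : Joins edge light far
      light-unique : ∀ {f g} → f ∈ L → f ≢ edge → g ∈ L → g ≢ edge →
                     Incident light f → Incident light g → f ≡ g

module Degeneracy {n} (G : Graph n) (chordless : Chordless G) (L : List (Edge G)) where
  open Edges G

  Linked : Fin n → Fin n → Set
  Linked u w = ∃ λ e → e ∈ L × Joins e u w

  record Path : Set where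
    field
      k         : ℕ
      vertex    : Fin (suc (suc k)) → Fin n
      injective : Injective _≡_ _≡_ vertex
      linked    : ∀ i j → toℕ j ≡ suc (toℕ i) → Linked (vertex i) (vertex j)

    start : Fin n
    start = vertex Fin.zero

    Maximal : Set
    Maximal = ∀ f → f ∈ L → Incident start f → ∃ λ i → vertex i ≡ other start f

    Extends : Edge G → Set
    Extends f = Incident start f × (∀ i → vertex i ≢ other start f)

    Extends? : ∀ f → Dec (Extends f)
    Extends? f = Incident? start f ×-dec FinP.all? (λ i → ¬? (vertex i Fin.≟ other start f))

    extend : ∀ {f} → f ∈ L → Extends f → Path
    extend {f} f∈L (start∈f , fresh) = record
      { k = suc k ; vertex = vertex′ ; injective = injective′ ; linked = linked′ }
      where
      vertex′ : Fin (suc (suc (suc k))) → Fin n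
      vertex′ Fin.zero    = other start f
      vertex′ (Fin.suc i) = vertex i
      injective′ : Injective _≡_ _≡_ vertex′
      injective′ {Fin.zero}  {Fin.zero}  _  = refl
      injective′ {Fin.zero}  {Fin.suc j} eq = contradiction (sym eq) (fresh j)
      injective′ {Fin.suc i} {Fin.zero}  eq = contradiction eq (fresh i)
      injective′ {Fin.suc i} {Fin.suc j} eq = cong Fin.suc (injective eq)
      linked′ : ∀ i j → toℕ j ≡ suc (toℕ i) → Linked (vertex′ i) (vertex′ j)
      linked′ Fin.zero (Fin.suc Fin.zero) _ = f , f∈L , Joins-sym (Joins-other start∈f)
      linked′ (Fin.suc i) (Fin.suc j) eq = linked i j (ℕP.suc-injective eq)

    no-chord : ∀ {i j} → 2 ≤ toℕ i → toℕ i < toℕ j →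
               Adj G start (vertex i) → ¬ Adj G start (vertex j)
    no-chord {i} {j} 2≤i i<j start~i start~j =
      Sum.[ not-forward , not-backward ] (chordless K cycle is-cycle Fin.zero i′ chord)
      where
      K = suc (toℕ j)
      pos : Fin K → Fin (suc (suc k))
      pos m = Fin.inject≤ m (FinP.toℕ<n j)
      toℕ-pos : ∀ m → toℕ (pos m) ≡ toℕ m
      toℕ-pos m = FinP.toℕ-inject≤ m (FinP.toℕ<n j)
      pos-at : ∀ {m} l → toℕ m ≡ toℕ l → pos m ≡ l
      pos-at l eq = FinP.toℕ-injective (trans (toℕ-pos _) eq)
      cycle : Fin K → Fin n
      cycle m = vertex (pos m)
      3≤j : 3 ≤ toℕ j
      3≤j = ℕP.≤-trans (s≤s 2≤i) i<j
      consecutive : ∀ a b → Consec a b → Adj G (cycle a) (cycle b)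
      consecutive a b (inj₁ b≡1+a) =
        Joins-adj (proj₂ (proj₂ (linked (pos a) (pos b)
          (trans (toℕ-pos b) (trans b≡1+a (cong suc (sym (toℕ-pos a))))))))
      consecutive a b (inj₂ (a≡j , b≡0)) =
        subst₂ (λ u w → Adj G (vertex u) (vertex w))
          (sym (pos-at j a≡j)) (sym (pos-at Fin.zero b≡0))
          (subst T (adj-sym G _ _) start~j)
      is-cycle : IsCycle G K cycle
      is-cycle = ℕP.≤-trans 3≤j (ℕP.n≤1+n _)
               , (λ a b eq → FinP.toℕ-injective
                   (trans (sym (toℕ-pos a)) (trans (cong toℕ (injective eq)) (toℕ-pos b))))
               , consecutive
      i′ : Fin K
      i′ = Fin.fromℕ< (s≤s (ℕP.<⇒≤ i<j))
      toℕ-i′ : toℕ i′ ≡ toℕ i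
      toℕ-i′ = FinP.toℕ-fromℕ< _
      chord : Adj G (cycle Fin.zero) (cycle i′)
      chord = subst₂ (λ u w → Adj G (vertex u) (vertex w))
                (sym (pos-at Fin.zero refl)) (sym (pos-at i toℕ-i′)) start~i
      not-forward : ¬ Consec Fin.zero i′
      not-forward (inj₁ i′≡1)     = ℕP.<-irrefl (sym (trans (sym toℕ-i′) i′≡1)) 2≤i
      not-forward (inj₂ (0≡j , _)) = ℕP.<-irrefl 0≡j (ℕP.<-≤-trans (s≤s z≤n) 3≤j)
      not-backward : ¬ Consec i′ Fin.zero
      not-backward (inj₂ (i′≡j , _)) = ℕP.<-irrefl (trans (sym toℕ-i′) i′≡j) i<j

    reducible : Maximal → ReducibleEdge L
    reducible maximal = record
      { edge = e ; edge∈L = e∈L ; light = start ; far = vertex second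
      ; joins = e-joins ; light-unique = light-unique }
      where
      second : Fin (suc (suc k))
      second = Fin.suc Fin.zero
      e-linked = linked Fin.zero second refl
      e   = proj₁ e-linked
      e∈L = proj₁ (proj₂ e-linked)
      e-joins = proj₂ (proj₂ e-linked)
      beyond-second : ∀ {f i} → f ≢ e → Joins f start (vertex i) → 2 ≤ toℕ i
      beyond-second {i = Fin.zero}            _   f-joins = contradiction f-joins Joins-irrefl
      beyond-second {i = Fin.suc Fin.zero}    f≢e f-joins =
        contradiction (Joins-injective f-joins e-joins) f≢e
      beyond-second {i = Fin.suc (Fin.suc _)} _   _       = s≤s (s≤s z≤n)
      on-path : ∀ {f} → f ∈ L → Incident start f → ∃ λ i → Joins f start (vertex i)
      on-path {f} f∈L start∈f with maximal f f∈L start∈f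
      ... | i , vi≡other = i , subst (Joins f start) (sym vi≡other) (Joins-other start∈f)
      light-unique : ∀ {f g} → f ∈ L → f ≢ e → g ∈ L → g ≢ e →
                     Incident start f → Incident start g → f ≡ g
      light-unique f∈L f≢e g∈L g≢e start∈f start∈g
        with on-path f∈L start∈f | on-path g∈L start∈g
      ... | i , f-joins | j , g-joins with FinP.<-cmp i j
      ...   | tri< i<j _ _ = contradiction (Joins-adj g-joins)
                               (no-chord (beyond-second f≢e f-joins) i<j (Joins-adj f-joins))
      ...   | tri≈ _ refl _ = Joins-injective f-joins g-joins
      ...   | tri> _ _ j<i = contradiction (Joins-adj f-joins)
                               (no-chord (beyond-second g≢e g-joins) j<i (Joins-adj g-joins))

  edge-as-path : ∀ {e} → e ∈ L → Path
  edge-as-path {e} e∈L =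
    record { k = 0 ; vertex = vertex ; injective = injective ; linked = linked }
    where
    vertex : Fin 2 → Fin n
    vertex Fin.zero    = proj₁ (ends G e)
    vertex (Fin.suc _) = proj₂ (ends G e)
    u≢w : proj₁ (ends G e) ≢ proj₂ (ends G e)
    u≢w u≡w = FinP.<-irrefl u≡w (proj₁ (proj₂ e))
    injective : Injective _≡_ _≡_ vertex
    injective {Fin.zero}         {Fin.zero}         _   = refl
    injective {Fin.zero}         {Fin.suc Fin.zero} u≡w = contradiction u≡w u≢w
    injective {Fin.suc Fin.zero} {Fin.zero}         w≡u = contradiction (sym w≡u) u≢w
    injective {Fin.suc Fin.zero} {Fin.suc Fin.zero} _   = refl
    linked : ∀ i j → toℕ j ≡ suc (toℕ i) → Linked (vertex i) (vertex j)
    linked Fin.zero (Fin.suc Fin.zero) _ = e , e∈L , forward refl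

  maximal-path : ∀ fuel (P : Path) → n < fuel ℕ.+ suc (suc (Path.k P)) → Σ Path Path.Maximal
  maximal-path zero P n<k = contradiction (FinP.injective⇒≤ (Path.injective P)) (ℕP.<⇒≱ n<k)
  maximal-path (suc fuel) P n<fuel+k with search (Path.Extends? P) L
  ... | inj₁ (f , f∈L , extends) =
    maximal-path fuel (Path.extend P f∈L extends)
      (subst (n <_) (sym (ℕP.+-suc fuel (suc (suc (Path.k P))))) n<fuel+k)
  ... | inj₂ stuck = P , maximal
    where
    open Path P
    maximal : Maximal
    maximal f f∈L start∈f with FinP.any? (λ i → vertex i Fin.≟ other start f)
    ... | yes found = found
    ... | no absent = contradiction (start∈f , λ i eq → absent (i , eq)) (stuck f f∈L)

  reducible : ∀ {e₀} → e₀ ∈ L → ReducibleEdge L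
  reducible e₀∈L =
    let P , maximal = maximal-path n (edge-as-path e₀∈L)
                        (subst (n <_) (ℕP.+-comm 2 n) (ℕP.m<n+m n (s≤s z≤n)))
    in  Path.reducible P maximal

module Restricted {n} (G : Graph n) (t : ℕ) where
  open Edges G

  EqOn : (Edge G → Set) → Coloring G t → Coloring G t → Set
  EqOn F α β = ∀ e → F e → α e ≡ β e

  ProperOn : (Edge G → Set) → Coloring G t → Set
  ProperOn F α = ∀ e f → F e → F f → AdjEdges G e f → α e ≢ α f

  Step : (Edge G → Bool) → Edge G → Edge G → Set
  Step S e f = T (S e) × T (S f) × Share G e f

  record KempeChainOn (F : Edge G → Set) (α : Coloring G t) (c d : Fin t)
                      (S : Edge G → Bool) : Set where
    field
      within    : ∀ e → T (S e) → F e
      coloured  : ∀ e → T (S e) → InCD G α c d e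
      nonempty  : ∃ λ e → T (S e)
      closed    : ∀ e f → T (S e) → F f → InCD G α c d f → Share G e f → T (S f)
      connected : ∀ e f → T (S e) → T (S f) → Star (Step S) e f

  record KChangeOn (F : Edge G → Set) (α β : Coloring G t) : Set where
    field
      c d       : Fin t
      S         : Edge G → Bool
      c≢d       : c ≢ d
      chain     : KempeChainOn F α c d S
      swapped   : ∀ e → T (S e) → β e ≡ swap c d (α e)
      unchanged : ∀ e → F e → ¬ T (S e) → β e ≡ α e

  -- Nonempty on purpose: without function extensionality, pointwise equal colourings are
  -- not related by the empty sequence, whereas a nonempty one can be retargeted
  -- (KPathOn-respʳ).
  KPathOn : (Edge G → Set) → Coloring G t → Coloring G t → Set
  KPathOn F = TransClosure (KChangeOn F)

  ProperOn-⊆ : ∀ {F F′ α} → F′ ⊆ F → ProperOn F α → ProperOn F′ α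
  ProperOn-⊆ F′⊆F α-proper e f e∈F′ f∈F′ = α-proper e f (F′⊆F e∈F′) (F′⊆F f∈F′)

  module _ {F : Edge G → Set} where

    KChangeOn-respʳ : ∀ {α β β′} → KChangeOn F α β → EqOn F β β′ → KChangeOn F α β′
    KChangeOn-respʳ k β≗β′ = record
      { c = c ; d = d ; S = S ; c≢d = c≢d ; chain = chain
      ; swapped   = λ e e∈S → trans (sym (β≗β′ e (within e e∈S))) (swapped e e∈S)
      ; unchanged = λ e e∈F e∉S → trans (sym (β≗β′ e e∈F)) (unchanged e e∈F e∉S) }
      where
      open KChangeOn k
      open KempeChainOn chain

    KChangeOn-respˡ : ∀ {α α′ β} → KChangeOn F α β → EqOn F α α′ → KChangeOn F α′ β
    KChangeOn-respˡ k α≗α′ = record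
      { c = c ; d = d ; S = S ; c≢d = c≢d
      ; chain = record
        { within    = within
        ; coloured  = λ e e∈S → subst (OneOf c d) (α≗α′ e (within e e∈S)) (coloured e e∈S)
        ; nonempty  = nonempty
        ; closed    = λ e f e∈S f∈F cd →
                        closed e f e∈S f∈F (subst (OneOf c d) (sym (α≗α′ f f∈F)) cd)
        ; connected = connected }
      ; swapped   = λ e e∈S → trans (swapped e e∈S) (cong (swap c d) (α≗α′ e (within e e∈S)))
      ; unchanged = λ e e∈F e∉S → trans (unchanged e e∈F e∉S) (α≗α′ e e∈F) }
      where
      open KChangeOn k
      open KempeChainOn chain

    module _ {α β} (k : KChangeOn F α β) where
      open KChangeOn k
      open KempeChainOn chain

      private
        leaves : ∀ e f → T (S e) → F f → ¬ T (S f) → Share G e f → β e ≢ β f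
        leaves e f e∈S f∈F f∉S share βe≡βf with OneOf? c d (α f)
        ... | yes cd = f∉S (closed e f e∈S f∈F cd share)
        ... | no ¬cd = ¬cd (subst (OneOf c d)
                         (trans (sym (swapped e e∈S)) (trans βe≡βf (unchanged f f∈F f∉S)))
                         (swap-OneOf c d (coloured e e∈S)))

      KChangeOn-proper : ProperOn F α → ProperOn F β
      KChangeOn-proper α-proper e f e∈F f∈F e~f@(_ , share) βe≡βf with T? (S e) | T? (S f)
      ... | yes e∈S | yes f∈S = α-proper e f e∈F f∈F e~f
        (swap-injective c d (trans (sym (swapped e e∈S)) (trans βe≡βf (swapped f f∈S))))
      ... | yes e∈S | no f∉S  = leaves e f e∈S f∈F f∉S share βe≡βf
      ... | no e∉S  | yes f∈S = leaves f e f∈S e∈F e∉S (Share-sym e f share) (sym βe≡βf)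
      ... | no e∉S  | no f∉S  = α-proper e f e∈F f∈F e~f
        (trans (sym (unchanged e e∈F e∉S)) (trans βe≡βf (unchanged f f∈F f∉S)))

    KPathOn-respʳ : ∀ {α β β′} → KPathOn F α β → EqOn F β β′ → KPathOn F α β′
    KPathOn-respʳ [ k ]    β≗β′ = [ KChangeOn-respʳ k β≗β′ ]
    KPathOn-respʳ (k ∷ ks) β≗β′ = k ∷ KPathOn-respʳ ks β≗β′

    KPathOn-proper : ∀ {α β} → KPathOn F α β → ProperOn F α → ProperOn F β
    KPathOn-proper [ k ]    = KChangeOn-proper k
    KPathOn-proper (k ∷ ks) = KPathOn-proper ks ∘ KChangeOn-proper k

    KChangeOn⇒KChange : (∀ e → F e) → ∀ {α β} → KChangeOn F α β → KChange {G = G} α β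
    KChangeOn⇒KChange all k =
      c , d , S , c≢d , (coloured , nonempty , (λ e f e∈S → closed e f e∈S (all f)) , connected)
      , swapped , (λ e → unchanged e (all e))
      where
      open KChangeOn k
      open KempeChainOn chain

    KPathOn⇒KEquiv : (∀ e → F e) → ∀ {α β} → KPathOn F α β → KEquiv G α β
    KPathOn⇒KEquiv all [ k ]    = KChangeOn⇒KChange all k ◅ ε
    KPathOn⇒KEquiv all (k ∷ ks) = KChangeOn⇒KChange all k ◅ KPathOn⇒KEquiv all ks

  module _ {F F′ : Edge G → Set} (F≐F′ : F ≐ F′) where

    KChangeOn-resp-≐ : ∀ {α β} → KChangeOn F α β → KChangeOn F′ α β
    KChangeOn-resp-≐ k = record
      { c = c ; d = d ; S = S ; c≢d = c≢d
      ; chain = record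
        { within    = λ e e∈S → proj₁ F≐F′ (within e e∈S)
        ; coloured  = coloured
        ; nonempty  = nonempty
        ; closed    = λ e f e∈S f∈F′ → closed e f e∈S (proj₂ F≐F′ f∈F′)
        ; connected = connected }
      ; swapped   = swapped
      ; unchanged = λ e e∈F′ → unchanged e (proj₂ F≐F′ e∈F′) }
      where
      open KChangeOn k
      open KempeChainOn chain

    KPathOn-resp-≐ : ∀ {α β} → KPathOn F α β → KPathOn F′ α β
    KPathOn-resp-≐ [ k ]    = [ KChangeOn-resp-≐ k ]
    KPathOn-resp-≐ (k ∷ ks) = KChangeOn-resp-≐ k ∷ KPathOn-resp-≐ ks

  recolour : Coloring G t → Edge G → Fin t → Coloring G t
  recolour φ e b f with f ≟ᵉ e
  ... | yes _ = b
  ... | no _  = φ f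

  recolour-self : ∀ φ e b → recolour φ e b e ≡ b
  recolour-self φ e b with e ≟ᵉ e
  ... | yes _  = refl
  ... | no e≢e = contradiction refl e≢e

  recolour-other : ∀ φ {e f} b → f ≢ e → recolour φ e b f ≡ φ f
  recolour-other φ {e} {f} b f≢e with f ≟ᵉ e
  ... | yes f≡e = contradiction f≡e f≢e
  ... | no _    = refl

  module _ {F : Edge G → Set} where

    single-edge-change : ∀ {φ ψ e b} → F e → φ e ≢ b → ProperOn F φ →
                         (∀ f → F f → f ≢ e → Share G e f → φ f ≢ b) →
                         ψ e ≡ b → (∀ f → F f → f ≢ e → ψ f ≡ φ f) → KChangeOn F φ ψ
    single-edge-change {φ} {ψ} {e} {b} e∈F φe≢b φ-proper b-missing ψe≡b ψ-elsewhere = record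
      { c = φ e ; d = b ; S = S ; c≢d = φe≢b
      ; chain = record
        { within    = λ f f∈S → subst F (sym (is-e f∈S)) e∈F
        ; coloured  = λ f f∈S → inj₁ (cong φ (is-e f∈S))
        ; nonempty  = e , e∈S
        ; closed    = closed
        ; connected = λ f g f∈S g∈S →
                        subst (Star (Step S) f) (trans (is-e f∈S) (sym (is-e g∈S))) ε }
      ; swapped   = λ f f∈S → subst (λ f → ψ f ≡ swap (φ e) b (φ f)) (sym (is-e f∈S))
                                (trans ψe≡b (sym (swap-fst (φ e) b)))
      ; unchanged = λ f f∈F f∉S → ψ-elsewhere f f∈F (λ f≡e → f∉S (subst (T ∘ S) (sym f≡e) e∈S)) }
      where
      S : Edge G → Bool
      S f = ⌊ f ≟ᵉ e ⌋
      is-e : ∀ {f} → T (S f) → f ≡ e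
      is-e {f} = toWitness {a? = f ≟ᵉ e}
      e∈S : T (S e)
      e∈S = fromWitness {a? = e ≟ᵉ e} refl
      closed : ∀ f g → T (S f) → F g → OneOf (φ e) b (φ g) → Share G f g → T (S g)
      closed f g f∈S g∈F colour share with g ≟ᵉ e | is-e f∈S
      ... | yes _   | _    = _
      ... | no g≢e  | refl with colour
      ...   | inj₁ φg≡φe = contradiction (sym φg≡φe)
                             (φ-proper e g e∈F g∈F (adjacent (g≢e ∘ sym) share))
      ...   | inj₂ φg≡b  = contradiction φg≡b (b-missing g g∈F g≢e share)

    KPathOn-complete-at : ∀ {e α γ β} → F e → KPathOn F α γ → ProperOn F α → ProperOn F β →
                          (∀ f → F f → f ≢ e → β f ≡ γ f) → KPathOn F α β
    KPathOn-complete-at {e} {α} {γ} {β} e∈F α⇝γ α-proper β-proper agree with γ e Fin.≟ β e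
    ... | yes γe≡βe = KPathOn-respʳ α⇝γ γ≗β
      where
      γ≗β : EqOn F γ β
      γ≗β f f∈F with f ≟ᵉ e
      ... | yes refl = γe≡βe
      ... | no f≢e   = sym (agree f f∈F f≢e)
    ... | no γe≢βe = α⇝γ ∷ʳ single-edge-change e∈F γe≢βe (KPathOn-proper α⇝γ α-proper)
                              βe-missing refl agree
      where
      βe-missing : ∀ f → F f → f ≢ e → Share G e f → γ f ≢ β e
      βe-missing f f∈F f≢e share γf≡βe = β-proper f e f∈F e∈F (adjacent f≢e (Share-sym e f share))
                                           (trans (agree f f∈F f≢e) γf≡βe)

    module _ {e} (e∈F : F e) (only-e : ∀ f → F f → f ≡ e) where

      private
        no-adjacent-pair : ∀ {φ} → ProperOn F φ
        no-adjacent-pair f g f∈F g∈F (ends≢ , _) =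
          contradiction (cong (ends G) (trans (only-e f f∈F) (sym (only-e g g∈F)))) ends≢

        change : ∀ {φ ψ} → φ e ≢ ψ e → KChangeOn F φ ψ
        change φe≢ψe = single-edge-change e∈F φe≢ψe no-adjacent-pair
          (λ f f∈F f≢e → contradiction (only-e f f∈F) f≢e) refl
          (λ f f∈F f≢e → contradiction (only-e f f∈F) f≢e)

      KPathOn-single-edge : ∀ {α β b} → b ≢ α e → KPathOn F α β
      KPathOn-single-edge {α} {β} {b} b≢αe with α e Fin.≟ β e
      ... | no αe≢βe  = [ change αe≢βe ]
      ... | yes αe≡βe = change {ψ = λ _ → b} (b≢αe ∘ sym)
                      ∷ [ change (λ b≡βe → b≢αe (trans b≡βe (sym αe≡βe))) ]

module Lifting {n} (G : Graph n) {t} (L : List (Edge G)) (r : Edges.ReducibleEdge G L)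
               (far-degree : degree G (Edges.ReducibleEdge.far r) < t) where
  open Edges G
  open Restricted G t
  open ReducibleEdge r renaming (edge to e; edge∈L to e∈L; light to v; far to x)

  L∖e : Edge G → Set
  L∖e f = f ∈ L × f ≢ e

  recolour-agrees : ∀ ψ b → EqOn L∖e ψ (recolour ψ e b)
  recolour-agrees ψ b f (_ , f≢e) = sym (recolour-other ψ b f≢e)

  module _ {φ ψ} (k : KChangeOn L∖e φ ψ) where
    open KChangeOn k
    open KempeChainOn chain

    lift-apart : ∀ {φ₁} → EqOn L∖e φ₁ φ → (∀ s → T (S s) → Share G s e → ¬ OneOf c d (φ₁ e)) →
                 KChangeOn (_∈ L) φ₁ (recolour ψ e (φ₁ e))
    lift-apart {φ₁} φ₁≗φ apart = record
      { c = c ; d = d ; S = S ; c≢d = c≢d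
      ; chain = record
        { within    = λ s s∈S → proj₁ (within s s∈S)
        ; coloured  = λ s s∈S → subst (OneOf c d) (sym (φ₁≗φ s (within s s∈S))) (coloured s s∈S)
        ; nonempty  = nonempty
        ; closed    = closed′
        ; connected = connected }
      ; swapped   = λ s s∈S → trans (recolour-other ψ _ (proj₂ (within s s∈S)))
                      (trans (swapped s s∈S) (cong (swap c d) (sym (φ₁≗φ s (within s s∈S)))))
      ; unchanged = unchanged′ }
      where
      closed′ : ∀ s f → T (S s) → f ∈ L → OneOf c d (φ₁ f) → Share G s f → T (S f)
      closed′ s f s∈S f∈L cd share with f ≟ᵉ e
      ... | yes refl = contradiction cd (apart s s∈S share)
      ... | no f≢e   =
        closed s f s∈S (f∈L , f≢e) (subst (OneOf c d) (φ₁≗φ f (f∈L , f≢e)) cd) share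
      unchanged′ : ∀ f → f ∈ L → ¬ T (S f) → recolour ψ e (φ₁ e) f ≡ φ₁ f
      unchanged′ f f∈L f∉S with f ≟ᵉ e
      ... | yes refl = refl
      ... | no f≢e   = trans (unchanged f (f∈L , f≢e) f∉S) (sym (φ₁≗φ f (f∈L , f≢e)))

    module Touching (φ-proper : ProperOn (_∈ L) φ) (φe-cd : OneOf c d (φ e))
                    {s₀} (s₀∈S : T (S s₀)) (e-s₀ : Share G e s₀) where

      d′ : Fin t
      d′ = swap c d (φ e)

      meets-e-d′ : ∀ {f} → L∖e f → Share G e f → OneOf c d (φ f) → φ f ≡ d′
      meets-e-d′ {f} (f∈L , f≢e) share cd with OneOf-swap c d φe-cd cd
      ... | inj₁ φf≡φe = contradiction (sym φf≡φe)
                           (φ-proper e f e∈L f∈L (adjacent (f≢e ∘ sym) share))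
      ... | inj₂ φf≡d′ = φf≡d′

      φs₀≡d′ : φ s₀ ≡ d′
      φs₀≡d′ = meets-e-d′ (within s₀ s₀∈S) e-s₀ (coloured s₀ s₀∈S)

      d′-unique : ∀ {w f} → f ∈ L → Incident w f → Incident w s₀ → φ f ≡ d′ → f ≡ s₀
      d′-unique {f = f} f∈L w∈f w∈s₀ φf≡d′ with f ≟ᵉ s₀
      ... | yes f≡s₀ = f≡s₀
      ... | no f≢s₀  = contradiction (trans φf≡d′ (sym φs₀≡d′))
                         (φ-proper f s₀ f∈L (proj₁ (within s₀ s₀∈S))
                           (adjacent f≢s₀ (incident-Share f s₀ w∈f w∈s₀)))

      HasD′ : Fin n → Set
      HasD′ w = ∃ λ f → L∖e f × Incident w f × φ f ≡ d′

      HasD′? : ∀ w → Dec (HasD′ w)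
      HasD′? w with search (λ f → ¬? (f ≟ᵉ e) ×-dec Incident? w f ×-dec φ f Fin.≟ d′) L
      ... | inj₁ (f , f∈L , f≢e , w∈f , φf≡d′) = yes (f , (f∈L , f≢e) , w∈f , φf≡d′)
      ... | inj₂ none = no (λ (f , (f∈L , f≢e) , w∈f , φf≡d′) → none f f∈L (f≢e , w∈f , φf≡d′))

      -- When at most one end of e sees d′, the chain through s₀ simply continues along e.
      module Absorbing (¬both : ¬ (HasD′ v × HasD′ x)) where

        Sₑ : Edge G → Bool
        Sₑ f = S f ∨ ⌊ f ≟ᵉ e ⌋

        split : ∀ {f} → T (Sₑ f) → T (S f) ⊎ f ≡ e
        split {f} f∈Sₑ = Sum.map₂ (toWitness {a? = f ≟ᵉ e}) (Equivalence.to T-∨ f∈Sₑ)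

        S⊆Sₑ : ∀ {f} → T (S f) → T (Sₑ f)
        S⊆Sₑ f∈S = Equivalence.from T-∨ (inj₁ f∈S)

        e∈Sₑ : T (Sₑ e)
        e∈Sₑ = Equivalence.from T-∨ (inj₂ (fromWitness {a? = e ≟ᵉ e} refl))

        is-s₀ : ∀ {f} → L∖e f → Share G e f → OneOf c d (φ f) → f ≡ s₀
        is-s₀ {f} f∈L∖e@(f∈L , _) share cd
          with Joins-Share f joins share | Joins-Share s₀ joins e-s₀ | meets-e-d′ f∈L∖e share cd
        ... | inj₁ v∈f | inj₁ v∈s₀ | φf≡d′ = d′-unique f∈L v∈f v∈s₀ φf≡d′
        ... | inj₂ x∈f | inj₂ x∈s₀ | φf≡d′ = d′-unique f∈L x∈f x∈s₀ φf≡d′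
        ... | inj₁ v∈f | inj₂ x∈s₀ | φf≡d′ = contradiction
          ((_ , f∈L∖e , v∈f , φf≡d′) , (s₀ , within s₀ s₀∈S , x∈s₀ , φs₀≡d′)) ¬both
        ... | inj₂ x∈f | inj₁ v∈s₀ | φf≡d′ = contradiction
          ((s₀ , within s₀ s₀∈S , v∈s₀ , φs₀≡d′) , (_ , f∈L∖e , x∈f , φf≡d′)) ¬both

        closedₑ : ∀ s f → T (Sₑ s) → f ∈ L → OneOf c d (φ f) → Share G s f → T (Sₑ f)
        closedₑ s f s∈Sₑ f∈L cd share = by-cases (f ≟ᵉ e) (split s∈Sₑ)
          where
          by-cases : Dec (f ≡ e) → T (S s) ⊎ s ≡ e → T (Sₑ f)
          by-cases (yes refl) _           = e∈Sₑ
          by-cases (no f≢e)   (inj₁ s∈S)  = S⊆Sₑ (closed s f s∈S (f∈L , f≢e) cd share)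
          by-cases (no f≢e)   (inj₂ refl) =
            S⊆Sₑ (subst (T ∘ S) (sym (is-s₀ (f∈L , f≢e) share cd)) s₀∈S)

        widen : ∀ {f g} → Star (Step S) f g → Star (Step Sₑ) f g
        widen = gmap (λ f → f) (λ (f∈S , g∈S , share) → S⊆Sₑ f∈S , S⊆Sₑ g∈S , share)

        connectedₑ : ∀ f g → T (Sₑ f) → T (Sₑ g) → Star (Step Sₑ) f g
        connectedₑ f g f∈Sₑ g∈Sₑ with split f∈Sₑ | split g∈Sₑ
        ... | inj₁ f∈S  | inj₁ g∈S  = widen (connected f g f∈S g∈S)
        ... | inj₁ f∈S  | inj₂ refl =
          widen (connected f s₀ f∈S s₀∈S) ◅◅ ((S⊆Sₑ s₀∈S , e∈Sₑ , Share-sym e s₀ e-s₀) ◅ ε)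
        ... | inj₂ refl | inj₁ g∈S  = (e∈Sₑ , S⊆Sₑ s₀∈S , e-s₀) ◅ widen (connected s₀ g s₀∈S g∈S)
        ... | inj₂ refl | inj₂ refl = ε

        swappedₑ : ∀ f → T (Sₑ f) → recolour ψ e d′ f ≡ swap c d (φ f)
        swappedₑ f f∈Sₑ with split f∈Sₑ
        ... | inj₁ f∈S  = trans (recolour-other ψ d′ (proj₂ (within f f∈S))) (swapped f f∈S)
        ... | inj₂ refl = recolour-self ψ e d′

        unchangedₑ : ∀ f → f ∈ L → ¬ T (Sₑ f) → recolour ψ e d′ f ≡ φ f
        unchangedₑ f f∈L f∉Sₑ = by-cases (f ≟ᵉ e)
          where
          by-cases : Dec (f ≡ e) → recolour ψ e d′ f ≡ φ f
          by-cases (yes refl) = contradiction e∈Sₑ f∉Sₑ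
          by-cases (no f≢e)   =
            trans (recolour-other ψ d′ f≢e) (unchanged f (f∈L , f≢e) (f∉Sₑ ∘ S⊆Sₑ))

        lift-absorbing : KChangeOn (_∈ L) φ (recolour ψ e d′)
        lift-absorbing = record
          { c = c ; d = d ; S = Sₑ ; c≢d = c≢d
          ; chain = record
            { within    = λ f f∈Sₑ → Sum.[ proj₁ ∘ within f , (λ { refl → e∈L }) ] (split f∈Sₑ)
            ; coloured  = λ f f∈Sₑ → Sum.[ coloured f , (λ { refl → φe-cd }) ] (split f∈Sₑ)
            ; nonempty  = e , e∈Sₑ
            ; closed    = closedₑ
            ; connected = connectedₑ }
          ; swapped   = swappedₑ
          ; unchanged = unchangedₑ }

      -- When both ends of e see d′, e is first moved to a colour missing at both ends,
      -- which exists since v sees only d′ besides e and x has fewer than t edges.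
      lift-recolouring : HasD′ v → HasD′ x → ∃ λ b → KPathOn (_∈ L) φ (recolour ψ e b)
      lift-recolouring (h , (h∈L , h≢e) , v∈h , φh≡d′) (h′ , (h′∈L , _) , x∈h′ , φh′≡d′) =
        φ₁ e , recolour-e ∷ [ lift-apart (λ f (_ , f≢e) → recolour-other φ b f≢e) off-chain ]
        where
        b-missing = missing-colour φ x far-degree L
        b = proj₁ b-missing
        φ₁ = recolour φ e b
        φe≢b : φ e ≢ b
        φe≢b = proj₂ b-missing e e∈L (Joins-incident (Joins-sym joins))
        d′≢b : d′ ≢ b
        d′≢b = subst (_≢ b) φh′≡d′ (proj₂ b-missing h′ h′∈L x∈h′)
        missing-at-e : ∀ f → f ∈ L → f ≢ e → Share G e f → φ f ≢ b
        missing-at-e f f∈L f≢e share with Joins-Share f joins share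
        ... | inj₁ v∈f = subst (λ g → φ g ≢ b) (sym (light-unique f∈L f≢e h∈L h≢e v∈f v∈h))
                           (subst (_≢ b) (sym φh≡d′) d′≢b)
        ... | inj₂ x∈f = proj₂ b-missing f f∈L x∈f
        recolour-e : KChangeOn (_∈ L) φ φ₁
        recolour-e = single-edge-change e∈L φe≢b φ-proper missing-at-e
                       (recolour-self φ e b) (λ f _ f≢e → recolour-other φ b f≢e)
        off-chain : ∀ s → T (S s) → Share G s e → ¬ OneOf c d (φ₁ e)
        off-chain _ _ _ cd with OneOf-swap c d φe-cd (subst (OneOf c d) (recolour-self φ e b) cd)
        ... | inj₁ b≡φe = φe≢b (sym b≡φe)
        ... | inj₂ b≡d′ = d′≢b (sym b≡d′)

      lift-touching : ∃ λ b → KPathOn (_∈ L) φ (recolour ψ e b)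
      lift-touching with HasD′? v | HasD′? x
      ... | yes has-v | yes has-x = lift-recolouring has-v has-x
      ... | no ¬has-v | _         = d′ , [ Absorbing.lift-absorbing (¬has-v ∘ proj₁) ]
      ... | yes _     | no ¬has-x = d′ , [ Absorbing.lift-absorbing (¬has-x ∘ proj₂) ]

    lift-step : ProperOn (_∈ L) φ → ∃ λ b → KPathOn (_∈ L) φ (recolour ψ e b)
    lift-step φ-proper with OneOf? c d (φ e)
    ... | no ¬cd = φ e , [ lift-apart (λ _ _ → refl) (λ _ _ _ → ¬cd) ]
    ... | yes cd with search (λ s → T? (S s) ×-dec Share? e s) L
    ...   | inj₂ untouched = φ e , [ lift-apart (λ _ _ → refl) (λ s s∈S share _ →
                               untouched s (proj₁ (within s s∈S)) (s∈S , Share-sym s e share)) ]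
    ...   | inj₁ (_ , _ , s₀∈S , e-s₀) = Touching.lift-touching φ-proper cd s₀∈S e-s₀

  lift-path : ∀ {α′ β′} → KPathOn L∖e α′ β′ → ∀ {α} → ProperOn (_∈ L) α → EqOn L∖e α′ α →
              ∃ λ γ → KPathOn (_∈ L) α γ × EqOn L∖e β′ γ
  lift-path {β′ = β′} [ k ] α-proper α′≗α
    with lift-step (KChangeOn-respˡ k α′≗α) α-proper
  ... | b , α⇝γ = recolour β′ e b , α⇝γ , recolour-agrees β′ b
  lift-path (_∷_ {y = ψ} k ks) α-proper α′≗α
    with lift-step (KChangeOn-respˡ k α′≗α) α-proper
  ... | b , α⇝γ with lift-path ks (KPathOn-proper α⇝γ α-proper) (recolour-agrees ψ b)
  ...   | δ , γ⇝δ , β′≗δ = δ , α⇝γ ++ γ⇝δ , β′≗δ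

module Connected {n} (G : Graph n) (chordless : Chordless G)
                 {t} (degree<t : ∀ x → degree G x < t) where
  open Edges G
  open Restricted G t

  kempe-connected : ∀ m L → length L ≤ m → ∀ {e₀} → e₀ ∈ L →
                    ∀ {α β} → ProperOn (_∈ L) α → ProperOn (_∈ L) β → KPathOn (_∈ L) α β
  kempe-connected zero    []      _  ()
  kempe-connected zero    (_ ∷ _) ()
  kempe-connected (suc m) L |L|≤1+m e₀∈L {α} {β} α-proper β-proper =
    reduce (Degeneracy.reducible G chordless L e₀∈L)
    where
    reduce : ReducibleEdge L → KPathOn (_∈ L) α β
    reduce r = by-cases (search (λ f → ¬? (f ≟ᵉ edge)) L)
      where
      open ReducibleEdge r
      by-cases : (∃ λ f → f ∈ L × f ≢ edge) ⊎ (∀ f → f ∈ L → ¬ f ≢ edge) → KPathOn (_∈ L) α β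
      by-cases (inj₂ only-e) =
        KPathOn-single-edge edge∈L (λ f f∈L → decidable-stable (f ≟ᵉ edge) (only-e f f∈L))
          (proj₂ b-missing edge edge∈L (Joins-incident (Joins-sym joins)) ∘ sym)
        where
        b-missing = missing-colour α far (degree<t far) L
      by-cases (inj₁ (e₁ , e₁∈L , e₁≢e)) =
        KPathOn-complete-at edge∈L (proj₁ (proj₂ lifted)) α-proper β-proper
          (λ f f∈L f≢e → proj₂ (proj₂ lifted) f (f∈L , f≢e))
        where
        L′ = remove edge L
        L′⊆L : (_∈ L′) ⊆ (_∈ L)
        L′⊆L = proj₁ ∘ ∈-remove⁻ L
        rest : KPathOn (_∈ L′) α β
        rest = kempe-connected m L′ (ℕP.≤-pred (ℕP.<-≤-trans (length-remove edge∈L) |L|≤1+m))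
                 (∈-remove⁺ e₁∈L e₁≢e) (ProperOn-⊆ L′⊆L α-proper) (ProperOn-⊆ L′⊆L β-proper)
        lifted = Lifting.lift-path G L r (degree<t far)
                   (KPathOn-resp-≐ (∈-remove⁻ L , λ (f∈L , f≢e) → ∈-remove⁺ f∈L f≢e) rest)
                   α-proper (λ _ _ → refl)

corollary1p4 : (n : ℕ) (G : Graph n) → Chordless G → 3 ≤ maxDegree G →
    (α β : Coloring G (suc (maxDegree G))) → Proper G α → Proper G β →
    KEquiv G α β
corollary1p4 n G chordless 3≤Δ α β α-proper β-proper =
  KPathOn⇒KEquiv ∈-allEdges
    (kempe-connected (length allEdges) allEdges ℕP.≤-refl (∈-allEdges e₀)
      (λ e f _ _ → α-proper e f) (λ e f _ _ → β-proper e f))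
  where
  open Edges G
  open Restricted G (suc (maxDegree G))
  open Connected G chordless (s≤s ∘ degree≤maxDegree)
  e₀ : Edge G
  e₀ = positive-maxDegree⇒Edge (ℕP.≤-trans (s≤s z≤n) 3≤Δ)
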